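{- Suppose we have an algorithm that, given any \textsc{swamp} instance, returns a nonempty set $T$ with $\Gamma(T)\ge\alpha\cdot\max_{\emptyset\ne U}\Gamma(U)$ (an $\alpha$-approximation). Then the algorithm below, using this subroutine, yields an $\frac{\alpha}{\alpha+1}$-approximation for \textsc{card-swamp}: for an instance $H$ and integer $\ell$ (with $\ell\le|V|$) it returns a set $Z$ with $|Z|\ge\ell$ and $\Gamma(Z)\ge\frac{\alpha}{\alpha+1}\max\{\Gamma(U):U\subseteq V,|U|\ge\ell\}$. Consequently, using as subroutine the peeling algorithm below (with bound functions $s_e$ satisfying $0\le s_e(i)\le r_e(i)$ and $r_e(i)-s_e(i-1)\le r_e(i+1)-s_e(i)$), one obtains a $\frac{1}{k+1}$-approximation for \textsc{card-swamp}, where $k$ is the maximum hyperedge size. Cardinality algorithm: set $S\leftarrow\emptyset$, $H_1\leftarrow H$, $i\leftarrow1$. While $|S|<\ell$: let $S_i$ be the (approximate) densest \textsc{swamp} solution in $H_i$ returned by the subroutine; $H_{i+1}\leftarrow\textsc{contract}(H_i,S_i)$; $S\leftarrow S\cup S_i$; $i\leftarrow i+1$. After the loop let $S'$ be $S_1\cup\dots\cup S_{i-2}$ padded with arbitrary nodes so that $|S'|=\ell$. Return whichever of $S$ and $S'$ has the higher density $\Gamma$ (in $H$). Peeling algorithm (for unit weights, weights absorbed into rewards): set $X\leftarrow V$, $Y\leftarrow V$; while $X\ne\emptyset$, choose $v\in\arg\min_{u\in X}\sum_{e\ni u}\big(r_e(|e\cap X|)-s_e(|e\cap X|-1)\big)$,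 set $X\leftarrow X\setminus\{v\}$, and if $\Gamma(X)\ge\Gamma(Y)$ set $Y\leftarrow X$; output $Y$.
   Context: A \textsc{swamp} instance is a hypergraph $H=(V,E,w,\{r_e\})$ with weights $w(e)\ge0$ and rewards $r_e\colon\{0,\dots,|e|\}\to\mathbb{R}_{\ge0}$, monotone nondecreasing with $r_e(0)=0$. For nonempty $S\subseteq V$, $f(S)=\sum_{e\in E}w(e)\,r_e(|e\cap S|)$ and $\Gamma(S)=f(S)/|S|$; \textsc{swamp} maximizes $\Gamma(S)$ over nonempty $S$. \textsc{card-swamp} maximizes $\Gamma(S)$ subject to $|S|\ge\ell$. For a set $U\subseteq V$, $\textsc{contract}(H,U)=(V',E',w',\{r'\})$ has node set $V'=V\setminus U$; each hyperedge $e\in E$ becomes $a=e\setminus U$ with the same weight, and with $j=|e\cap U|$ its reward is $r'_a(i)=r_e(i+j)-r_e(j)$.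
   Formalization: The edge weights $w(e)$, the rewards $r_e$, the bound functions $s_e$ and the factor $\alpha$ take rational values instead of real ones. -}

module Defs where

open import Data.Nat as ℕ using (ℕ; zero; suc; _∸_; _⊔_)
import Data.Nat.Properties as ℕP
import Data.Fin.Subset.Properties as SubP
open import Data.Integer using (+_)
open import Data.Rational using (ℚ; 0ℚ; _/_; _+_; _*_; _-_; _≤_; _<_)
open import Data.Rational.Properties using (_<?_)
open import Data.Fin using (Fin)
open import Data.Fin.Subset as Sub using (Subset; _∩_; _∪_; _─_; ∣_∣; ⋃; ⁅_⁆; Nonempty; _⊆_)
  renaming (_∈_ to _∈ₛ_)
open import Data.List using (List; []; _∷_; foldr; map; drop)
open import Data.List.Membership.Propositional using (_∈_)
open import Data.Product using (_×_; _,_; proj₁; proj₂)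
open import Relation.Nullary using (yes; no)
open import Relation.Binary.PropositionalEquality using (_≡_)
open import Data.Bool using (if_then_else_)
open import Relation.Nullary.Decidable using (⌊_⌋)

record Edge (n : ℕ) : Set where
  field
    nodes  : Subset n
    weight : ℚ
    reward : ℕ → ℚ         -- r_e, only values on {0,…,|e|} matter
open Edge public

record Instance (n : ℕ) : Set where
  field
    V     : Subset n
    edges : List (Edge n)
open Instance public

WellFormed : ∀ {n} → Instance n → Set
WellFormed H = ∀ e → e ∈ edges H →
    (nodes e ⊆ V H)
  × (0ℚ ≤ weight e)
  × (reward e 0 ≡ 0ℚ)
  × (∀ i → i ℕ.< ∣ nodes e ∣ → reward e i ≤ reward e (suc i))

toℚ : ℕ → ℚ
toℚ m = + m / 1

sumℚ : List ℚ → ℚ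
sumℚ = foldr _+_ 0ℚ

f : ∀ {n} → Instance n → Subset n → ℚ
f H S = sumℚ (map (λ e → weight e * reward e ∣ nodes e ∩ S ∣) (edges H))

-- Γ(S) = f(S)/|S|   (Γ(∅) := 0 by convention; never used for ∅ in the statement)
Γ : ∀ {n} → Instance n → Subset n → ℚ
Γ H S with ∣ S ∣
... | zero  = 0ℚ
... | suc m = f H S * (+ 1 / suc m)

maxEdgeSize : ∀ {n} → Instance n → ℕ
maxEdgeSize H = foldr (λ e k → ∣ nodes e ∣ ⊔ k) 0 (edges H)

contractEdge : ∀ {n} → Subset n → Edge n → Edge n
contractEdge U e = record
  { nodes  = nodes e ─ U
  ; weight = weight e
  ; reward = λ i → reward e (i ℕ.+ j) - reward e j
  }
  where j = ∣ nodes e ∩ U ∣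

contract : ∀ {n} → Instance n → Subset n → Instance n
contract H U = record { V = V H ─ U ; edges = map (contractEdge U) (edges H) }

IsApprox : ∀ {n} → ℚ → (Instance n → Subset n) → Set
IsApprox {n} α O = ∀ (H : Instance n) → WellFormed H → Nonempty (V H) →
    Nonempty (O H)
  × (O H ⊆ V H)
  × (∀ U → Nonempty U → U ⊆ V H → α * Γ H U ≤ Γ H (O H))

-- State: current instance H_i, S = S_1 ∪ … ∪ S_{i-1}, and the list
-- [S_{i-1}, …, S_1] (most recent first).  Fuel n suffices (each S_i is a
-- nonempty set of fresh nodes), so running out of fuel never happens under
-- the hypotheses.

cardLoop : ∀ {n} → ℕ → (Instance n → Subset n) → ℕ →
           Instance n → Subset n → List (Subset n) → Subset n × List (Subset n)
cardLoop zero    O ℓ Hi S Ss = S , Ss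
cardLoop (suc k) O ℓ Hi S Ss with ∣ S ∣ ℕP.<? ℓ
... | no  _ = S , Ss
... | yes _ = cardLoop k O ℓ (contract Hi (O Hi)) (S ∪ O Hi) (O Hi ∷ Ss)

cardS : ∀ {n} → (Instance n → Subset n) → ℕ → Instance n → Subset n
cardS {n} O ℓ H = proj₁ (cardLoop n O ℓ H Sub.⊥ [])

-- S_1 ∪ … ∪ S_{i-2}  (all but the last chosen set)
cardPrefix : ∀ {n} → (Instance n → Subset n) → ℕ → Instance n → Subset n
cardPrefix {n} O ℓ H = ⋃ (drop 1 (proj₂ (cardLoop n O ℓ H Sub.⊥ [])))

-- Output, given the (arbitrary) padding S' of the prefix to size ℓ:
-- whichever of S and S' has higher density Γ in H (S on ties).
cardAlg : ∀ {n} → (Instance n → Subset n) → ℕ → Instance n → Subset n → Subset n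
cardAlg O ℓ H S' =
  let S = cardS O ℓ H in
  if ⌊ Γ H S <? Γ H S' ⌋ then S' else S

IsPadding : ∀ {n} → (Instance n → Subset n) → ℕ → Instance n → Subset n → Set
IsPadding O ℓ H S' = (cardPrefix O ℓ H ⊆ S') × (S' ⊆ V H) × (∣ S' ∣ ≡ ℓ)

-- Peeling algorithm.  Weights are absorbed into rewards: the effective
-- reward of e is ρ_e(i) = w(e) · r_e(i).

ρ : ∀ {n} → Edge n → ℕ → ℚ
ρ e i = weight e * reward e i

BoundsOK : ∀ {n} → Instance n → (Edge n → ℕ → ℚ) → Set
BoundsOK H s = ∀ e → e ∈ edges H →
    (∀ i → i ℕ.≤ ∣ nodes e ∣ → (0ℚ ≤ s e i) × (s e i ≤ ρ e i))
  × (∀ i → 1 ℕ.≤ i → suc i ℕ.≤ ∣ nodes e ∣ →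
       ρ e i - s e (i ∸ 1) ≤ ρ e (suc i) - s e i)

score : ∀ {n} → Instance n → (Edge n → ℕ → ℚ) → Subset n → Fin n → ℚ
score H s X u = sumℚ (map term (edges H))
  where
  term : _ → ℚ
  term e with u SubP.∈? nodes e
  ... | yes _ = ρ e ∣ nodes e ∩ X ∣ - s e (∣ nodes e ∩ X ∣ ∸ 1)
  ... | no  _ = 0ℚ

Chooser : ℕ → Set
Chooser n = Instance n → Subset n → (Fin n → ℚ) → Fin n

IsArgminChooser : ∀ {n} → Chooser n → Set
IsArgminChooser {n} ch = ∀ H X (g : Fin n → ℚ) → Nonempty X →
    (ch H X g ∈ₛ X) × (∀ u → u ∈ₛ X → g (ch H X g) ≤ g u)

-- Peeling loop on (X, Y); the update Y ← X is only done while X ≠ ∅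
-- (Γ(∅) is undefined in the paper).
peelLoop : ∀ {n} → ℕ → Instance n → (Edge n → ℕ → ℚ) → Chooser n →
           Subset n → Subset n → Subset n
peelLoop zero    H s ch X Y = Y
peelLoop (suc k) H s ch X Y with ∣ X ∣
... | zero  = Y
... | suc _ with X Sub.- ch H X (score H s X)
...   | X' with ∣ X' ∣
...     | zero  = Y
...     | suc _ = peelLoop k H s ch X'
                    (if ⌊ Γ H X' <? Γ H Y ⌋ then Y else X')

peel : ∀ {n} → (Instance n → Edge n → ℕ → ℚ) → Chooser n → Instance n → Subset n
peel {n} s ch H = peelLoop n H (s H) ch (V H) (V H)

{-# OPTIONS --safe #-}
module Submission where

-- Both parts rest on one reduction.  Suppose the subroutine O satisfies a·Γ(T) ≤ b·Γ(O(H′)) for every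
-- nonempty T on every instance H′ of a class that is closed under contraction.  Fix U with |U| ≥ ℓ and
-- let S be the union of the sets chosen so far.  While |S| < ℓ, the set U ∖ S is feasible in the
-- contracted instance and is worth at least f(U) − f(S) there.  So unless S is already heavy,
-- i.e. (a+b)·f(S) ≥ a·f(U), each newly chosen set gains at least a/(a+b)·Γ(U) per node, and S stays
-- proportional: a·|S|·f(U) ≤ (a+b)·|U|·f(S).  If S is proportional at the end, Γ(S) ≥ a/(a+b)·Γ(U).
-- Otherwise some S was heavy at a stage after which the loop went on.  That S lies inside
-- S_1 ∪ … ∪ S_{i−2}, so the padded set S′ satisfies Γ(S′) ≥ a/(a+b)·f(U)/ℓ ≥ a/(a+b)·Γ(U).
-- For an α-approximation, (a, b) = (α, 1).
--
-- Peeling gives (a, b) = (1, k) on the instances whose edges have at most k nodes, a class closed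
-- under contraction.  Every nonempty T contains a nonempty W with Γ(W) ≥ Γ(T) that is locally dense:
-- removing any node from W loses at least Γ(W).  Consider the first time peeling removes a node v of
-- W, from the current set X ⊇ W.  Then v minimises the score on X.  The conditions on s bound the
-- score of v from below by the loss f(W) − f(W − v), and bound the total score on X from above by
-- k·f(X).  Hence Γ(W) ≤ score(v) ≤ k·f(X)/|X| = k·Γ(X), and Γ(X) is at most the density of the output.

open import Defs
open import Data.Nat as ℕ using (ℕ; zero; suc; z≤n; s≤s; _∸_; _≤_; _<_)
import Data.Nat.Properties as ℕP
import Data.Nat.Coprimality as Coprime
import Data.Integer as ℤ
import Data.Integer.Properties as ℤP
open import Data.Rational using (ℚ; 0ℚ; 1ℚ; mkℚ; _+_; _*_; _-_; -_; _/_; nonNegative; positive)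
  renaming (_≤_ to _≤ℚ_; _<_ to _<ℚ_)
open import Data.Rational.Properties
open import Data.Rational.Solver using (module +-*-Solver)
open import Data.Fin using (Fin; zero; suc)
open import Data.Fin.Properties using (all?; ¬∀⟶∃¬)
open import Data.Fin.Subset as Subset using (Subset; Nonempty; Empty; _⊆_; ∣_∣; _∩_; _∪_; _─_; ⋃; inside; outside)
  renaming (_∈_ to _∈ₛ_; _∉_ to _∉ₛ_; _-_ to _-ₛ_)
open import Data.Fin.Subset.Properties
open import Data.Vec using ([]; _∷_; here; there)
open import Data.List using (List; []; _∷_; drop; map; length)
open import Data.List.Membership.Propositional using (_∈_)
open import Data.List.Membership.Propositional.Properties using (∈-map⁻)
open import Data.List.Properties using (map-∘)
open import Data.List.Relation.Unary.Any using (here; there)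
open import Data.Bool using (_∧_; if_then_else_)
open import Data.Empty using (⊥-elim)
open import Data.Unit using (⊤; tt)
open import Data.Product using (_×_; _,_; proj₁; proj₂; ∃-syntax)
open import Data.Sum using (_⊎_; inj₁; inj₂; [_,_]′)
open import Function using (_∘_; id; const)
open import Relation.Nullary using (Dec; yes; no; ¬_)
open import Relation.Nullary.Decidable using (⌊_⌋; decidable-stable; _→-dec_)
open import Relation.Binary.PropositionalEquality
open +-*-Solver

private
  variable
    n : ℕ

-- Rational arithmetic

toℚ≡mkℚ : ∀ m → toℚ m ≡ mkℚ (ℤ.+ m) 0 (Coprime.sym (Coprime.1-coprimeTo m))
toℚ≡mkℚ m = normalize-coprime (Coprime.sym (Coprime.1-coprimeTo m))

toℚ-+ : ∀ m n → toℚ (m ℕ.+ n) ≡ toℚ m + toℚ n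
toℚ-+ m n = begin
  toℚ (m ℕ.+ n)                     ≡⟨ /-cong {+ (m ℕ.+ n)} {1} {_} {1} numerators refl ⟩
  (+ m ℤ.* + 1 ℤ.+ + n ℤ.* + 1) / 1 ≡⟨ cong₂ _+_ (toℚ≡mkℚ m) (toℚ≡mkℚ n) ⟨
  toℚ m + toℚ n                     ∎
  where
  open ≡-Reasoning
  open ℤ using (+_)
  numerators : + (m ℕ.+ n) ≡ + m ℤ.* + 1 ℤ.+ + n ℤ.* + 1
  numerators = trans (ℤP.pos-+ m n) (sym (cong₂ ℤ._+_ (ℤP.*-identityʳ (+ m)) (ℤP.*-identityʳ (+ n))))

-- Rewriting with this lemma, instead of leaving `toℚ 0 = 0ℚ` to conversion inside a larger term,
-- keeps Agda from normalising rational arithmetic on open terms.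
toℚ0≡0 : toℚ 0 ≡ 0ℚ
toℚ0≡0 = refl

toℚ-nonNeg : ∀ m → 0ℚ ≤ℚ toℚ m
toℚ-nonNeg m = nonNegative⁻¹ (toℚ m) {{normalize-nonNeg m 1}}

toℚ-pos : ∀ {m} → 0 < m → 0ℚ <ℚ toℚ m
toℚ-pos {suc m} _ = positive⁻¹ (toℚ (suc m)) {{normalize-pos (suc m) 1}}

toℚ-mono : ∀ {m n} → m ≤ n → toℚ m ≤ℚ toℚ n
toℚ-mono {m} m≤n with ℕP.m≤n⇒∃[o]m+o≡n m≤n
... | o , refl = begin
  toℚ m          ≡⟨ +-identityʳ (toℚ m) ⟨
  toℚ m + 0ℚ     ≤⟨ +-monoʳ-≤ (toℚ m) (toℚ-nonNeg o) ⟩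
  toℚ m + toℚ o  ≡⟨ toℚ-+ m o ⟨
  toℚ (m ℕ.+ o)  ∎
  where open ≤-Reasoning

toℚ*1/ : ∀ m → toℚ (suc m) * (ℤ.+ 1 / suc m) ≡ 1ℚ
toℚ*1/ m = trans (cong₂ _*_ (toℚ≡mkℚ (suc m)) (normalize-coprime (Coprime.1-coprimeTo (suc m))))
                 (*-inverseʳ (mkℚ (ℤ.+ suc m) 0 (Coprime.sym (Coprime.1-coprimeTo (suc m)))))

p≤q⇒0≤q-p : ∀ {p q} → p ≤ℚ q → 0ℚ ≤ℚ q - p
p≤q⇒0≤q-p {p} {q} p≤q = subst (_≤ℚ q - p) (+-inverseʳ p) (+-monoˡ-≤ (- p) p≤q)

0≤q-p⇒p≤q : ∀ {p q} → 0ℚ ≤ℚ q - p → p ≤ℚ q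
0≤q-p⇒p≤q {p} {q} 0≤q-p =
  subst₂ _≤ℚ_ (+-identityˡ p) (solve 2 (λ p q → q :- p :+ p := q) refl p q) (+-monoˡ-≤ p 0≤q-p)

p<q⇒0<q-p : ∀ {p q} → p <ℚ q → 0ℚ <ℚ q - p
p<q⇒0<q-p {p} {q} p<q = subst (_<ℚ q - p) (+-inverseʳ p) (+-monoˡ-< (- p) p<q)

0<q-p⇒p<q : ∀ {p q} → 0ℚ <ℚ q - p → p <ℚ q
0<q-p⇒p<q {p} {q} 0<q-p =
  subst₂ _<ℚ_ (+-identityˡ p) (solve 2 (λ p q → q :- p :+ p := q) refl p q) (+-monoˡ-< p 0<q-p)

p≤p+q : ∀ {p q} → 0ℚ ≤ℚ q → p ≤ℚ p + q
p≤p+q {p} 0≤q = subst (_≤ℚ p + _) (+-identityʳ p) (+-monoʳ-≤ p 0≤q)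

p-q≤p : ∀ {p q} → 0ℚ ≤ℚ q → p - q ≤ℚ p
p-q≤p {p} {q} 0≤q = subst (p - q ≤ℚ_) (solve 2 (λ p q → p :- q :+ q := p) refl p q) (p≤p+q 0≤q)

p-r≤p-q : ∀ p {q r} → q ≤ℚ r → p - r ≤ℚ p - q
p-r≤p-q p q≤r = +-monoʳ-≤ p (neg-antimono-≤ q≤r)

*-nonNeg : ∀ {p q} → 0ℚ ≤ℚ p → 0ℚ ≤ℚ q → 0ℚ ≤ℚ p * q
*-nonNeg {p} {q} 0≤p 0≤q = nonNegative⁻¹ (p * q) {{nonNeg*nonNeg⇒nonNeg p {{nonNegative 0≤p}} q {{nonNegative 0≤q}}}}

*-pos : ∀ {p q} → 0ℚ <ℚ p → 0ℚ <ℚ q → 0ℚ <ℚ p * q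
*-pos {p} {q} 0<p 0<q = positive⁻¹ (p * q) {{pos*pos⇒pos p {{positive 0<p}} q {{positive 0<q}}}}

*-monoˡ-≤-nonNeg′ : ∀ {r p q} → 0ℚ ≤ℚ r → p ≤ℚ q → r * p ≤ℚ r * q
*-monoˡ-≤-nonNeg′ {r} 0≤r = *-monoˡ-≤-nonNeg r {{nonNegative 0≤r}}

*-monoʳ-≤-nonNeg′ : ∀ {r p q} → 0ℚ ≤ℚ r → p ≤ℚ q → p * r ≤ℚ q * r
*-monoʳ-≤-nonNeg′ {r} 0≤r = *-monoʳ-≤-nonNeg r {{nonNegative 0≤r}}

*-cancelˡ-≤-pos′ : ∀ {r p q} → 0ℚ <ℚ r → r * p ≤ℚ r * q → p ≤ℚ q
*-cancelˡ-≤-pos′ {r} 0<r = *-cancelˡ-≤-pos r {{positive 0<r}}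

*-cancelʳ-≤-pos′ : ∀ {r p q} → 0ℚ <ℚ r → p * r ≤ℚ q * r → p ≤ℚ q
*-cancelʳ-≤-pos′ {r} 0<r = *-cancelʳ-≤-pos r {{positive 0<r}}

stepwise-mono : ∀ (g : ℕ → ℚ) {i j} → i ≤ j → (∀ k → i ≤ k → k < j → g k ≤ℚ g (suc k)) → g i ≤ℚ g j
stepwise-mono g {j = zero}  z≤n   _    = ≤-refl
stepwise-mono g {i} {suc j} i≤1+j step with ℕP.m≤n⇒m<n∨m≡n i≤1+j
... | inj₂ refl      = ≤-refl
... | inj₁ (s≤s i≤j) =
  ≤-trans (stepwise-mono g i≤j (λ k i≤k k<j → step k i≤k (ℕP.m≤n⇒m≤1+n k<j))) (step j i≤j ℕP.≤-refl)

-- Subsets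

x∈p⇒∣p∣>0 : ∀ {x : Fin n} {p} → x ∈ₛ p → 0 < ∣ p ∣
x∈p⇒∣p∣>0 x∈p = ℕP.≤-trans (s≤s z≤n) (x∈p⇒∣p-x∣<∣p∣ x∈p)

∣p∣>0⇒Nonempty : ∀ {n} {p : Subset n} → 0 < ∣ p ∣ → Nonempty p
∣p∣>0⇒Nonempty {n} {p} 0<∣p∣ = decidable-stable (nonempty? p) λ p-empty →
  ℕP.<⇒≢ 0<∣p∣ (sym (trans (cong ∣_∣ (Empty-unique p-empty)) (∣⊥∣≡0 n)))

x∈p─q⇒x∉q : ∀ {x : Fin n} p q → x ∈ₛ p ─ q → x ∉ₛ q
x∈p─q⇒x∉q (_ ∷ p) (inside ∷ q) ()        here
x∈p─q⇒x∉q (_ ∷ p) (_ ∷ q)      (there i) (there j) = x∈p─q⇒x∉q p q i j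

─-monoˡ : ∀ {p q : Subset n} r → p ⊆ q → p ─ r ⊆ q ─ r
─-monoˡ {p = p} r p⊆q x∈p─r = x∈p∧x∉q⇒x∈p─q (p⊆q (p─q⊆p p r x∈p─r)) (x∈p─q⇒x∉q p r x∈p─r)

∩-monoʳ-⊆ : ∀ (p : Subset n) {q r} → q ⊆ r → p ∩ q ⊆ p ∩ r
∩-monoʳ-⊆ p {q} q⊆r x∈p∩q = let x∈p , x∈q = x∈p∩q⁻ p q x∈p∩q in x∈p∩q⁺ (x∈p , q⊆r x∈q)

∪-lub : ∀ {p q r : Subset n} → p ⊆ r → q ⊆ r → p ∪ q ⊆ r
∪-lub {p = p} {q} p⊆r q⊆r x∈p∪q with x∈p∪q⁻ p q x∈p∪q
... | inj₁ x∈p = p⊆r x∈p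
... | inj₂ x∈q = q⊆r x∈q

p⊆q∪[p─q] : ∀ (p q : Subset n) → p ⊆ q ∪ (p ─ q)
p⊆q∪[p─q] p q {x} x∈p with x ∈? q
... | yes x∈q = p⊆p∪q (p ─ q) x∈q
... | no  x∉q = q⊆p∪q q (p ─ q) (x∈p∧x∉q⇒x∈p─q x∈p x∉q)

Empty[p─q]⇒p⊆q : ∀ (p q : Subset n) → Empty (p ─ q) → p ⊆ q
Empty[p─q]⇒p⊆q p q empty {x} x∈p with x ∈? q
... | yes x∈q = x∈q
... | no  x∉q = ⊥-elim (empty (x , x∈p∧x∉q⇒x∈p─q x∈p x∉q))

∣q∣<∣p∣⇒Nonempty[p─q] : ∀ (p q : Subset n) → ∣ q ∣ < ∣ p ∣ → Nonempty (p ─ q)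
∣q∣<∣p∣⇒Nonempty[p─q] p q ∣q∣<∣p∣ = decidable-stable (nonempty? (p ─ q)) λ p─q-empty →
  ℕP.<⇒≱ ∣q∣<∣p∣ (p⊆q⇒∣p∣≤∣q∣ (Empty[p─q]⇒p⊆q p q p─q-empty))

⋃-drop-⊆ : ∀ (ps : List (Subset n)) → ⋃ (drop 1 ps) ⊆ ⋃ ps
⋃-drop-⊆ []       = id
⋃-drop-⊆ (p ∷ ps) = q⊆p∪q p (⋃ ps)

∣[p─q]∩r∣+∣p∩q∣≡∣p∩[q∪r]∣ : ∀ (p q r : Subset n) → ∣ (p ─ q) ∩ r ∣ ℕ.+ ∣ p ∩ q ∣ ≡ ∣ p ∩ (q ∪ r) ∣
∣[p─q]∩r∣+∣p∩q∣≡∣p∩[q∪r]∣ []            []            []            = refl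
∣[p─q]∩r∣+∣p∩q∣≡∣p∩[q∪r]∣ (inside  ∷ p) (inside  ∷ q) (_ ∷ r)       =
  trans (ℕP.+-suc _ _) (cong suc (∣[p─q]∩r∣+∣p∩q∣≡∣p∩[q∪r]∣ p q r))
∣[p─q]∩r∣+∣p∩q∣≡∣p∩[q∪r]∣ (inside  ∷ p) (outside ∷ q) (inside  ∷ r) =
  cong suc (∣[p─q]∩r∣+∣p∩q∣≡∣p∩[q∪r]∣ p q r)
∣[p─q]∩r∣+∣p∩q∣≡∣p∩[q∪r]∣ (inside  ∷ p) (outside ∷ q) (outside ∷ r) = ∣[p─q]∩r∣+∣p∩q∣≡∣p∩[q∪r]∣ p q r
∣[p─q]∩r∣+∣p∩q∣≡∣p∩[q∪r]∣ (outside ∷ p) (inside  ∷ q) (_ ∷ r)       = ∣[p─q]∩r∣+∣p∩q∣≡∣p∩[q∪r]∣ p q r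
∣[p─q]∩r∣+∣p∩q∣≡∣p∩[q∪r]∣ (outside ∷ p) (outside ∷ q) (_ ∷ r)       = ∣[p─q]∩r∣+∣p∩q∣≡∣p∩[q∪r]∣ p q r

∣p─q∣+∣p∩q∣≡∣p∣ : ∀ (p q : Subset n) → ∣ p ─ q ∣ ℕ.+ ∣ p ∩ q ∣ ≡ ∣ p ∣
∣p─q∣+∣p∩q∣≡∣p∣ p q = begin
  ∣ p ─ q ∣ ℕ.+ ∣ p ∩ q ∣                ≡⟨ cong (λ r → ∣ r ∣ ℕ.+ ∣ p ∩ q ∣) (∩-identityʳ (p ─ q)) ⟨
  ∣ (p ─ q) ∩ Subset.⊤ ∣ ℕ.+ ∣ p ∩ q ∣   ≡⟨ ∣[p─q]∩r∣+∣p∩q∣≡∣p∩[q∪r]∣ p q Subset.⊤ ⟩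
  ∣ p ∩ (q ∪ Subset.⊤) ∣                 ≡⟨ cong (λ r → ∣ p ∩ r ∣) (∪-zeroʳ q) ⟩
  ∣ p ∩ Subset.⊤ ∣                       ≡⟨ cong ∣_∣ (∩-identityʳ p) ⟩
  ∣ p ∣                                  ∎
  where open ≡-Reasoning

∣p∪q∣≡∣p∣+∣q∣ : ∀ (p q : Subset n) → (∀ {x} → x ∈ₛ p → x ∉ₛ q) → ∣ p ∪ q ∣ ≡ ∣ p ∣ ℕ.+ ∣ q ∣
∣p∪q∣≡∣p∣+∣q∣ []            []            _        = refl
∣p∪q∣≡∣p∣+∣q∣ (inside  ∷ p) (inside  ∷ q) disjoint = ⊥-elim (disjoint here here)
∣p∪q∣≡∣p∣+∣q∣ (inside  ∷ p) (outside ∷ q) disjoint =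
  cong suc (∣p∪q∣≡∣p∣+∣q∣ p q (λ x∈p x∈q → disjoint (there x∈p) (there x∈q)))
∣p∪q∣≡∣p∣+∣q∣ (outside ∷ p) (inside  ∷ q) disjoint =
  trans (cong suc (∣p∪q∣≡∣p∣+∣q∣ p q (λ x∈p x∈q → disjoint (there x∈p) (there x∈q)))) (sym (ℕP.+-suc _ _))
∣p∪q∣≡∣p∣+∣q∣ (outside ∷ p) (outside ∷ q) disjoint =
  ∣p∪q∣≡∣p∣+∣q∣ p q (λ x∈p x∈q → disjoint (there x∈p) (there x∈q))

1+∣p∩[q-x]∣≡∣p∩q∣ : ∀ (p q : Subset n) {x} → x ∈ₛ p → x ∈ₛ q → suc ∣ p ∩ (q -ₛ x) ∣ ≡ ∣ p ∩ q ∣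
1+∣p∩[q-x]∣≡∣p∩q∣ (_ ∷ p) (_ ∷ q) here        here        = cong (λ r → suc ∣ p ∩ r ∣) (p─⊥≡p q)
1+∣p∩[q-x]∣≡∣p∩q∣ (b ∷ p) (c ∷ q) (there x∈p) (there x∈q) with b ∧ c
... | inside  = cong suc (1+∣p∩[q-x]∣≡∣p∩q∣ p q x∈p x∈q)
... | outside = 1+∣p∩[q-x]∣≡∣p∩q∣ p q x∈p x∈q

∣p∩[q-x]∣≡∣p∩q∣ : ∀ (p q : Subset n) {x} → x ∉ₛ p → ∣ p ∩ (q -ₛ x) ∣ ≡ ∣ p ∩ q ∣
∣p∩[q-x]∣≡∣p∩q∣ (inside  ∷ p) (_ ∷ q) {zero}  x∉p = ⊥-elim (x∉p here)
∣p∩[q-x]∣≡∣p∩q∣ (outside ∷ p) (_ ∷ q) {zero}  x∉p = cong (λ r → ∣ p ∩ r ∣) (p─⊥≡p q)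
∣p∩[q-x]∣≡∣p∩q∣ (b ∷ p)       (c ∷ q) {suc x} x∉p with b ∧ c
... | inside  = cong suc (∣p∩[q-x]∣≡∣p∩q∣ p q (x∉p ∘ there))
... | outside = ∣p∩[q-x]∣≡∣p∩q∣ p q (x∉p ∘ there)

1+∣p-x∣≡∣p∣ : ∀ (p : Subset n) {x} → x ∈ₛ p → suc ∣ p -ₛ x ∣ ≡ ∣ p ∣
1+∣p-x∣≡∣p∣ p {x} x∈p = begin
  suc ∣ p -ₛ x ∣               ≡⟨ cong (λ r → suc ∣ r ∣) (∩-identityˡ (p -ₛ x)) ⟨
  suc ∣ Subset.⊤ ∩ (p -ₛ x) ∣  ≡⟨ 1+∣p∩[q-x]∣≡∣p∩q∣ Subset.⊤ p ∈⊤ x∈p ⟩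
  ∣ Subset.⊤ ∩ p ∣             ≡⟨ cong ∣_∣ (∩-identityˡ p) ⟩
  ∣ p ∣                        ∎
  where open ≡-Reasoning

-- Sums

module _ {A : Set} where

  sumℚ-cong : ∀ {g h : A → ℚ} xs → (∀ x → x ∈ xs → g x ≡ h x) → sumℚ (map g xs) ≡ sumℚ (map h xs)
  sumℚ-cong []       _   = refl
  sumℚ-cong (x ∷ xs) g≡h = cong₂ _+_ (g≡h x (here refl)) (sumℚ-cong xs (λ y y∈xs → g≡h y (there y∈xs)))

  sumℚ-mono : ∀ {g h : A → ℚ} xs → (∀ x → x ∈ xs → g x ≤ℚ h x) → sumℚ (map g xs) ≤ℚ sumℚ (map h xs)
  sumℚ-mono []       _   = ≤-refl
  sumℚ-mono (x ∷ xs) g≤h = +-mono-≤ (g≤h x (here refl)) (sumℚ-mono xs (λ y y∈xs → g≤h y (there y∈xs)))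

  sumℚ-zero : ∀ {g : A → ℚ} xs → (∀ x → x ∈ xs → g x ≡ 0ℚ) → sumℚ (map g xs) ≡ 0ℚ
  sumℚ-zero []       _   = refl
  sumℚ-zero (x ∷ xs) g≡0 =
    trans (cong₂ _+_ (g≡0 x (here refl)) (sumℚ-zero xs (λ y y∈xs → g≡0 y (there y∈xs)))) (+-identityʳ 0ℚ)

  sumℚ-distrib-─ : ∀ (g h : A → ℚ) xs → sumℚ (map (λ x → g x - h x) xs) ≡ sumℚ (map g xs) - sumℚ (map h xs)
  sumℚ-distrib-─ g h []       = refl
  sumℚ-distrib-─ g h (x ∷ xs) = trans (cong (_+_ (g x - h x)) (sumℚ-distrib-─ g h xs))
    (solve 4 (λ a b c d → a :- b :+ (c :- d) := a :+ c :- (b :+ d))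
             refl (g x) (h x) (sumℚ (map g xs)) (sumℚ (map h xs)))

  sumℚ-distribˡ-* : ∀ c (g : A → ℚ) xs → sumℚ (map (λ x → c * g x) xs) ≡ c * sumℚ (map g xs)
  sumℚ-distribˡ-* c g []       = sym (*-zeroʳ c)
  sumℚ-distribˡ-* c g (x ∷ xs) = trans (cong (_+_ (c * g x)) (sumℚ-distribˡ-* c g xs)) (sym (*-distribˡ-+ c (g x) _))

sumOver : Subset n → (Fin n → ℚ) → ℚ
sumOver []            g = 0ℚ
sumOver (inside  ∷ X) g = g zero + sumOver X (g ∘ suc)
sumOver (outside ∷ X) g = sumOver X (g ∘ suc)

syntax sumOver X (λ u → t) = ∑[ u ∈ X ] t

sumOver-zero : ∀ (X : Subset n) → ∑[ u ∈ X ] 0ℚ ≡ 0ℚ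
sumOver-zero []            = refl
sumOver-zero (inside  ∷ X) = trans (+-identityˡ _) (sumOver-zero X)
sumOver-zero (outside ∷ X) = sumOver-zero X

sumOver-distrib-+ : ∀ (X : Subset n) g h → ∑[ u ∈ X ] (g u + h u) ≡ sumOver X g + sumOver X h
sumOver-distrib-+ []            g h = refl
sumOver-distrib-+ (inside  ∷ X) g h = trans (cong (_+_ (g zero + h zero)) (sumOver-distrib-+ X (g ∘ suc) (h ∘ suc)))
  (solve 4 (λ a b c d → a :+ b :+ (c :+ d) := a :+ c :+ (b :+ d)) refl (g zero) (h zero) _ _)
sumOver-distrib-+ (outside ∷ X) g h = sumOver-distrib-+ X (g ∘ suc) (h ∘ suc)

sumOver-sumℚ : ∀ {A : Set} (X : Subset n) (G : Fin n → A → ℚ) xs →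
  ∑[ u ∈ X ] sumℚ (map (G u) xs) ≡ sumℚ (map (λ x → ∑[ u ∈ X ] G u x) xs)
sumOver-sumℚ X G []       = sumOver-zero X
sumOver-sumℚ X G (x ∷ xs) = trans (sumOver-distrib-+ X (λ u → G u x) (λ u → sumℚ (map (G u) xs)))
  (cong (_+_ (sumOver X (λ u → G u x))) (sumOver-sumℚ X G xs))

∣X∣*c≤sumOver : ∀ (X : Subset n) g {c} → (∀ u → u ∈ₛ X → c ≤ℚ g u) → toℚ ∣ X ∣ * c ≤ℚ sumOver X g
∣X∣*c≤sumOver []            g {c} c≤g = ≤-reflexive (*-zeroˡ c)
∣X∣*c≤sumOver (inside  ∷ X) g {c} c≤g = begin
  toℚ (suc ∣ X ∣) * c           ≡⟨ cong (_* c) (toℚ-+ 1 ∣ X ∣) ⟩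
  (1ℚ + toℚ ∣ X ∣) * c          ≡⟨ solve 2 (λ t c → (con 1ℚ :+ t) :* c := c :+ t :* c) refl (toℚ ∣ X ∣) c ⟩
  c + toℚ ∣ X ∣ * c             ≤⟨ +-mono-≤ (c≤g zero here) (∣X∣*c≤sumOver X (g ∘ suc) (λ u → c≤g (suc u) ∘ there)) ⟩
  g zero + sumOver X (g ∘ suc)  ∎
  where open ≤-Reasoning
∣X∣*c≤sumOver (outside ∷ X) g c≤g = ∣X∣*c≤sumOver X (g ∘ suc) (λ u → c≤g (suc u) ∘ there)

sumOver-indicator : ∀ (X p : Subset n) g {c} → (∀ u → u ∈ₛ p → g u ≡ c) → (∀ u → u ∉ₛ p → g u ≡ 0ℚ) →
  sumOver X g ≡ toℚ ∣ p ∩ X ∣ * c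
sumOver-indicator []      []      g {c} _  _   = sym (*-zeroˡ c)
sumOver-indicator (x ∷ X) (y ∷ p) g {c} on off = go x y (on zero) (off zero)
  where
  rest : sumOver X (g ∘ suc) ≡ toℚ ∣ p ∩ X ∣ * c
  rest = sumOver-indicator X p (g ∘ suc) (λ u → on (suc u) ∘ there) (λ u u∉p → off (suc u) (u∉p ∘ drop-there))
  go : ∀ x y → (zero ∈ₛ y ∷ p → g zero ≡ c) → (zero ∉ₛ y ∷ p → g zero ≡ 0ℚ) →
    sumOver (x ∷ X) g ≡ toℚ ∣ (y ∷ p) ∩ (x ∷ X) ∣ * c
  go outside inside  _   _    = rest
  go outside outside _   _    = rest
  go inside  outside _   off₀ = trans (cong₂ _+_ (off₀ λ ()) rest) (+-identityˡ _)
  go inside  inside  on₀ _    = begin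
    g zero + sumOver X (g ∘ suc)  ≡⟨ cong₂ _+_ (on₀ here) rest ⟩
    c + toℚ ∣ p ∩ X ∣ * c         ≡⟨ solve 2 (λ t c → c :+ t :* c := (con 1ℚ :+ t) :* c) refl (toℚ ∣ p ∩ X ∣) c ⟩
    (1ℚ + toℚ ∣ p ∩ X ∣) * c      ≡⟨ cong (_* c) (toℚ-+ 1 ∣ p ∩ X ∣) ⟨
    toℚ (suc ∣ p ∩ X ∣) * c       ∎
    where open ≡-Reasoning

-- The objective f and the density Γ

module _ {n} {H : Instance n} (wf : WellFormed H) {e : Edge n} (e∈H : e ∈ edges H) where

  ρ-zero : ρ e 0 ≡ 0ℚ
  ρ-zero = trans (cong (weight e *_) (proj₁ (proj₂ (proj₂ (wf e e∈H))))) (*-zeroʳ (weight e))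

  ρ-mono : ∀ {i j} → i ≤ j → j ≤ ∣ nodes e ∣ → ρ e i ≤ℚ ρ e j
  ρ-mono i≤j j≤∣e∣ = *-monoˡ-≤-nonNeg′ (proj₁ (proj₂ (wf e e∈H))) (stepwise-mono (reward e) i≤j
    (λ k _ k<j → proj₂ (proj₂ (proj₂ (wf e e∈H))) k (ℕP.<-≤-trans k<j j≤∣e∣)))

  ρ-nonNeg : ∀ {i} → i ≤ ∣ nodes e ∣ → 0ℚ ≤ℚ ρ e i
  ρ-nonNeg i≤∣e∣ = subst (_≤ℚ ρ e _) ρ-zero (ρ-mono z≤n i≤∣e∣)

module _ {n} {H : Instance n} (wf : WellFormed H) where

  f-mono : ∀ {A B} → A ⊆ B → f H A ≤ℚ f H B
  f-mono {A} {B} A⊆B = sumℚ-mono (edges H) λ e e∈H →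
    ρ-mono wf e∈H (p⊆q⇒∣p∣≤∣q∣ (∩-monoʳ-⊆ (nodes e) A⊆B)) (∣p∩q∣≤∣p∣ (nodes e) B)

  f-⊥ : f H Subset.⊥ ≡ 0ℚ
  f-⊥ = sumℚ-zero (edges H) λ e e∈H →
    trans (cong (ρ e) (trans (cong ∣_∣ (∩-zeroʳ (nodes e))) (∣⊥∣≡0 n))) (ρ-zero wf e∈H)

  f-nonNeg : ∀ A → 0ℚ ≤ℚ f H A
  f-nonNeg A = subst (_≤ℚ f H A) f-⊥ (f-mono ⊥⊆)

  f-pos⇒Nonempty : ∀ {A} → 0ℚ <ℚ f H A → Nonempty A
  f-pos⇒Nonempty {A} 0<fA = decidable-stable (nonempty? A) λ A-empty →
    <-irrefl (sym (trans (cong (f H) (Empty-unique A-empty)) f-⊥)) 0<fA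

  Γ-nonNeg : ∀ S → 0ℚ ≤ℚ Γ H S
  Γ-nonNeg S with ∣ S ∣
  ... | zero  = ≤-refl
  ... | suc m = *-nonNeg (f-nonNeg S) (nonNegative⁻¹ _ {{normalize-nonNeg 1 (suc m)}})

edgeValue : Edge n → Subset n → ℚ
edgeValue e S = ρ e ∣ nodes e ∩ S ∣

f-contract : ∀ (H : Instance n) A X → f (contract H A) X ≡ f H (A ∪ X) - f H A
f-contract H A X = begin
  f (contract H A) X                                                ≡⟨ cong sumℚ (map-∘ (edges H)) ⟨
  sumℚ (map (λ e → edgeValue (contractEdge A e) X) (edges H))        ≡⟨ sumℚ-cong (edges H) (λ e _ → contracted e) ⟩
  sumℚ (map (λ e → edgeValue e (A ∪ X) - edgeValue e A) (edges H))  ≡⟨ sumℚ-distrib-─ _ _ (edges H) ⟩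
  f H (A ∪ X) - f H A                                               ∎
  where
  open ≡-Reasoning
  contracted : ∀ e → edgeValue (contractEdge A e) X ≡ edgeValue e (A ∪ X) - edgeValue e A
  contracted e = trans
    (cong (λ i → weight e * (reward e i - reward e ∣ nodes e ∩ A ∣)) (∣[p─q]∩r∣+∣p∩q∣≡∣p∩[q∪r]∣ (nodes e) A X))
    (solve 3 (λ w r s → w :* (r :- s) := w :* r :- w :* s) refl (weight e) _ _)

wf-contract : ∀ {H : Instance n} A → WellFormed H → WellFormed (contract H A)
wf-contract A wf a a∈ with ∈-map⁻ (contractEdge A) a∈
... | e , e∈H , refl with wf e e∈H
... | e⊆V , 0≤w , _ , r-step =
  ─-monoˡ A e⊆V , 0≤w , +-inverseʳ (reward e j) ,
  λ i i<∣e─A∣ → +-monoˡ-≤ (- reward e j) (r-step (i ℕ.+ j)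
    (subst (i ℕ.+ j <_) (∣p─q∣+∣p∩q∣≡∣p∣ (nodes e) A) (ℕP.+-monoˡ-< j i<∣e─A∣)))
  where
  j : ℕ
  j = ∣ nodes e ∩ A ∣

∣e∣≤maxEdgeSize : ∀ (H : Instance n) {e} → e ∈ edges H → ∣ nodes e ∣ ≤ maxEdgeSize H
∣e∣≤maxEdgeSize H = go (edges H)
  where
  go : ∀ es {e} → e ∈ es → ∣ nodes e ∣ ≤ maxEdgeSize (record { V = V H ; edges = es })
  go (_ ∷ es) (here refl) = ℕP.m≤m⊔n _ _
  go (_ ∷ es) (there e∈)  = ℕP.≤-trans (go es e∈) (ℕP.m≤n⊔m _ _)

maxEdgeSize-contract : ∀ (H : Instance n) A → maxEdgeSize (contract H A) ≤ maxEdgeSize H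
maxEdgeSize-contract H A = go (edges H)
  where
  go : ∀ es → maxEdgeSize (record { V = V H ─ A ; edges = map (contractEdge A) es })
            ≤ maxEdgeSize (record { V = V H ; edges = es })
  go []       = z≤n
  go (e ∷ es) = ℕP.⊔-mono-≤ (∣p─q∣≤∣p∣ (nodes e) A) (go es)

Γ*∣S∣≡f : ∀ (H : Instance n) S → 0 < ∣ S ∣ → Γ H S * toℚ ∣ S ∣ ≡ f H S
Γ*∣S∣≡f H S _ with ∣ S ∣
... | suc m = begin
  f H S * (ℤ.+ 1 / suc m) * toℚ (suc m)    ≡⟨ *-assoc (f H S) _ _ ⟩
  f H S * ((ℤ.+ 1 / suc m) * toℚ (suc m))  ≡⟨ cong (f H S *_) (trans (*-comm _ (toℚ (suc m))) (toℚ*1/ m)) ⟩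
  f H S * 1ℚ                               ≡⟨ *-identityʳ (f H S) ⟩
  f H S                                    ∎
  where open ≡-Reasoning

≤*Γ : ∀ (H : Instance n) S {c d} → 0 < ∣ S ∣ → c * toℚ ∣ S ∣ ≤ℚ d * f H S → c ≤ℚ d * Γ H S
≤*Γ H S {c} {d} 0<∣S∣ c∣S∣≤df = *-cancelʳ-≤-pos′ (toℚ-pos 0<∣S∣) (begin
  c * toℚ ∣ S ∣            ≤⟨ c∣S∣≤df ⟩
  d * f H S                ≡⟨ cong (d *_) (Γ*∣S∣≡f H S 0<∣S∣) ⟨
  d * (Γ H S * toℚ ∣ S ∣)  ≡⟨ *-assoc d _ _ ⟨
  d * Γ H S * toℚ ∣ S ∣    ∎)
  where open ≤-Reasoning

module _ (H : Instance n) {A B : Subset n} (c d : ℚ) (0<∣A∣ : 0 < ∣ A ∣) (0<∣B∣ : 0 < ∣ B ∣) where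

  private
    scaleˡ : c * Γ H A * (toℚ ∣ A ∣ * toℚ ∣ B ∣) ≡ c * f H A * toℚ ∣ B ∣
    scaleˡ = trans
      (solve 4 (λ c γ a b → c :* γ :* (a :* b) := c :* (γ :* a) :* b) refl c (Γ H A) (toℚ ∣ A ∣) (toℚ ∣ B ∣))
      (cong (λ x → c * x * toℚ ∣ B ∣) (Γ*∣S∣≡f H A 0<∣A∣))

    scaleʳ : d * Γ H B * (toℚ ∣ A ∣ * toℚ ∣ B ∣) ≡ d * f H B * toℚ ∣ A ∣
    scaleʳ = trans
      (solve 4 (λ d γ a b → d :* γ :* (a :* b) := d :* (γ :* b) :* a) refl d (Γ H B) (toℚ ∣ A ∣) (toℚ ∣ B ∣))
      (cong (λ x → d * x * toℚ ∣ A ∣) (Γ*∣S∣≡f H B 0<∣B∣))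

    0<∣A∣∣B∣ : 0ℚ <ℚ toℚ ∣ A ∣ * toℚ ∣ B ∣
    0<∣A∣∣B∣ = *-pos (toℚ-pos 0<∣A∣) (toℚ-pos 0<∣B∣)

  *Γ≤*Γ⇒cross : c * Γ H A ≤ℚ d * Γ H B → c * f H A * toℚ ∣ B ∣ ≤ℚ d * f H B * toℚ ∣ A ∣
  *Γ≤*Γ⇒cross cΓ≤dΓ = subst₂ _≤ℚ_ scaleˡ scaleʳ (*-monoʳ-≤-nonNeg′ (<⇒≤ 0<∣A∣∣B∣) cΓ≤dΓ)

  cross⇒*Γ≤*Γ : c * f H A * toℚ ∣ B ∣ ≤ℚ d * f H B * toℚ ∣ A ∣ → c * Γ H A ≤ℚ d * Γ H B
  cross⇒*Γ≤*Γ cross = *-cancelʳ-≤-pos′ 0<∣A∣∣B∣ (subst₂ _≤ℚ_ (sym scaleˡ) (sym scaleʳ) cross)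

denser : Instance n → Subset n → Subset n → Subset n
denser H A B = if ⌊ Γ H A <? Γ H B ⌋ then B else A

module _ (H : Instance n) (A B : Subset n) where

  denser-preserves : ∀ (P : Subset n → Set) → P A → P B → P (denser H A B)
  denser-preserves P PA PB with Γ H A <? Γ H B
  ... | yes _ = PB
  ... | no  _ = PA

  Γ≤Γ-denserˡ : Γ H A ≤ℚ Γ H (denser H A B)
  Γ≤Γ-denserˡ with Γ H A <? Γ H B
  ... | yes ΓA<ΓB = <⇒≤ ΓA<ΓB
  ... | no  _     = ≤-refl

  Γ≤Γ-denserʳ : Γ H B ≤ℚ Γ H (denser H A B)
  Γ≤Γ-denserʳ with Γ H A <? Γ H B
  ... | yes _     = ≤-refl
  ... | no  ΓA≮ΓB = ≮⇒≥ ΓA≮ΓB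

-- The cardinality algorithm

cardLoop-invariant : ∀ {O : Instance n → Subset n} {ℓ} (Q : Instance n → Subset n → List (Subset n) → Set) →
  (∀ {Hi S Ss} → Q Hi S Ss → ∣ S ∣ < ℓ → Q (contract Hi (O Hi)) (S ∪ O Hi) (O Hi ∷ Ss)) →
  ∀ k {Hi S Ss} → Q Hi S Ss →
    (∃[ Hf ] Q Hf (proj₁ (cardLoop k O ℓ Hi S Ss)) (proj₂ (cardLoop k O ℓ Hi S Ss)))
  × (ℓ ≤ ∣ proj₁ (cardLoop k O ℓ Hi S Ss) ∣ ⊎ k ℕ.+ length Ss ≡ length (proj₂ (cardLoop k O ℓ Hi S Ss)))
cardLoop-invariant Q step zero {Hi} q = (Hi , q) , inj₂ refl
cardLoop-invariant {ℓ = ℓ} Q step (suc k) {Hi} {S} {Ss} q with ∣ S ∣ ℕP.<? ℓ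
... | no  ∣S∣≮ℓ = (Hi , q) , inj₁ (ℕP.≮⇒≥ ∣S∣≮ℓ)
... | yes ∣S∣<ℓ with cardLoop-invariant Q step k (step q ∣S∣<ℓ)
...   | reached , inj₁ ℓ≤∣S∣      = reached , inj₁ ℓ≤∣S∣
...   | reached , inj₂ all-rounds = reached , inj₂ (trans (sym (ℕP.+-suc k (length Ss))) all-rounds)

-- The inequality behind one round of the algorithm: F = f(U), φ = f(S), Δ is the value the chosen set A
-- adds to S, t = |A|, τ = |U ∖ S| and u = |U|.
gain-bound : ∀ {a b F φ Δ t τ u} → 0ℚ ≤ℚ a → 0ℚ ≤ℚ b → 0ℚ <ℚ t → 0ℚ ≤ℚ Δ → τ ≤ℚ u →
  (a + b) * φ <ℚ a * F → a * (F - φ) * t ≤ℚ b * Δ * τ → a * F * t ≤ℚ (a + b) * Δ * u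
gain-bound {a} {b} {F} {φ} {Δ} {t} {τ} {u} 0≤a 0≤b 0<t 0≤Δ τ≤u [a+b]φ<aF gain with 0ℚ <? b
... | yes 0<b = 0≤q-p⇒p≤q (*-cancelˡ-≤-pos′ 0<b (begin
  b * 0ℚ                                                                     ≡⟨ *-zeroʳ b ⟩
  0ℚ                                                                         ≤⟨ +-mono-≤
    (*-nonNeg (+-mono-≤ 0≤a 0≤b) (p≤q⇒0≤q-p (≤-trans gain (*-monoˡ-≤-nonNeg′ (*-nonNeg 0≤b 0≤Δ) τ≤u))))
    (*-nonNeg (*-nonNeg 0≤a (<⇒≤ 0<t)) (p≤q⇒0≤q-p (<⇒≤ [a+b]φ<aF))) ⟩
  (a + b) * (b * Δ * u - a * (F - φ) * t) + a * t * (a * F - (a + b) * φ)  ≡⟨ identity ⟨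
  b * ((a + b) * Δ * u - a * F * t)                                          ∎))
  where
  open ≤-Reasoning
  identity : b * ((a + b) * Δ * u - a * F * t)
           ≡ (a + b) * (b * Δ * u - a * (F - φ) * t) + a * t * (a * F - (a + b) * φ)
  identity = solve 7 (λ a b F φ Δ t u → b :* ((a :+ b) :* Δ :* u :- a :* F :* t)
                      := (a :+ b) :* (b :* Δ :* u :- a :* (F :- φ) :* t) :+ a :* t :* (a :* F :- (a :+ b) :* φ))
                     refl a b F φ Δ t u
... | no 0≮b = ⊥-elim (<-irrefl refl (<-≤-trans 0<[F-φ]t (begin
  a * (F - φ) * t  ≤⟨ gain ⟩
  b * Δ * τ        ≡⟨ cong (λ b → b * Δ * τ) b≡0 ⟩
  0ℚ * Δ * τ       ≡⟨ solve 2 (λ Δ τ → con 0ℚ :* Δ :* τ := con 0ℚ) refl Δ τ ⟩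
  0ℚ               ∎)))
  where
  open ≤-Reasoning
  b≡0 : b ≡ 0ℚ
  b≡0 = ≤-antisym (≮⇒≥ 0≮b) 0≤b
  aφ<aF : (a + 0ℚ) * φ <ℚ a * F
  aφ<aF = subst (λ b → (a + b) * φ <ℚ a * F) b≡0 [a+b]φ<aF
  0<[F-φ]t : 0ℚ <ℚ a * (F - φ) * t
  0<[F-φ]t = *-pos (subst (0ℚ <ℚ_) (solve 3 (λ a F φ → a :* F :- (a :+ con 0ℚ) :* φ := a :* (F :- φ)) refl a F φ)
                            (p<q⇒0<q-p aφ<aF))
                   0<t

IsApproxOn : (Instance n → Set) → ℚ → ℚ → (Instance n → Subset n) → Set
IsApproxOn P a b O = ∀ Hi → P Hi → WellFormed Hi → Nonempty (V Hi) →
    Nonempty (O Hi)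
  × (O Hi ⊆ V Hi)
  × (∀ T → Nonempty T → T ⊆ V Hi → a * Γ Hi T ≤ℚ b * Γ Hi (O Hi))

IsApprox⇒IsApproxOn : ∀ {α} {O : Instance n → Subset n} → IsApprox α O → IsApproxOn (λ _ → ⊤) α 1ℚ O
IsApprox⇒IsApproxOn approx H _ wf V-nonempty =
  let O-nonempty , O⊆V , bound = approx H wf V-nonempty in
  O-nonempty , O⊆V , λ T T-nonempty T⊆V → subst (_ ≤ℚ_) (sym (*-identityˡ _)) (bound T T-nonempty T⊆V)

module Reduction {n} {P : Instance n → Set} (P-contract : ∀ {Hi} A → P Hi → P (contract Hi A))
  {a b : ℚ} (0≤a : 0ℚ ≤ℚ a) (0≤b : 0ℚ ≤ℚ b) {O : Instance n → Subset n} (approx : IsApproxOn P a b O)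
  {H : Instance n} (wf : WellFormed H) (PH : P H) {ℓ : ℕ} (ℓ≤∣V∣ : ℓ ≤ ∣ V H ∣) where

  0≤a+b : 0ℚ ≤ℚ a + b
  0≤a+b = +-mono-≤ 0≤a 0≤b

  record Invariant (Hi : Instance n) (S : Subset n) (Ss : List (Subset n)) : Set where
    field
      wellFormed : WellFormed Hi
      inClass    : P Hi
      V≡         : V Hi ≡ V H ─ S
      S⊆V        : S ⊆ V H
      f≡         : ∀ X → f Hi X ≡ f H (S ∪ X) - f H S
      ⋃≡         : ⋃ Ss ≡ S
      length≤    : length Ss ≤ ∣ S ∣

  invariant-init : Invariant H Subset.⊥ []
  invariant-init = record
    { wellFormed = wf
    ; inClass    = PH
    ; V≡         = sym (p─⊥≡p (V H))
    ; S⊆V        = ⊥⊆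
    ; f≡         = λ X → sym (trans (cong₂ _-_ (cong (f H) (∪-identityˡ X)) (f-⊥ wf)) (+-identityʳ (f H X)))
    ; ⋃≡         = refl
    ; length≤    = z≤n
    }

  module Step {Hi S Ss} (inv : Invariant Hi S Ss) (∣S∣<ℓ : ∣ S ∣ < ℓ) where
    open Invariant inv

    A : Subset n
    A = O Hi

    Vi-nonempty : Nonempty (V Hi)
    Vi-nonempty = subst Nonempty (sym V≡) (∣q∣<∣p∣⇒Nonempty[p─q] (V H) S (ℕP.<-≤-trans ∣S∣<ℓ ℓ≤∣V∣))

    A-nonempty : Nonempty A
    A-nonempty = proj₁ (approx Hi inClass wellFormed Vi-nonempty)

    A⊆Vi : A ⊆ V Hi
    A⊆Vi = proj₁ (proj₂ (approx Hi inClass wellFormed Vi-nonempty))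

    A-approx : ∀ T → Nonempty T → T ⊆ V Hi → a * Γ Hi T ≤ℚ b * Γ Hi A
    A-approx = proj₂ (proj₂ (approx Hi inClass wellFormed Vi-nonempty))

    A⊆V─S : A ⊆ V H ─ S
    A⊆V─S = subst (A ⊆_) V≡ A⊆Vi

    ∣S∪A∣≡∣S∣+∣A∣ : ∣ S ∪ A ∣ ≡ ∣ S ∣ ℕ.+ ∣ A ∣
    ∣S∪A∣≡∣S∣+∣A∣ = ∣p∪q∣≡∣p∣+∣q∣ S A (λ x∈S x∈A → x∈p─q⇒x∉q (V H) S (A⊆V─S x∈A) x∈S)

    invariant-step : Invariant (contract Hi A) (S ∪ A) (A ∷ Ss)
    invariant-step = record
      { wellFormed = wf-contract A wellFormed
      ; inClass    = P-contract A inClass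
      ; V≡         = trans (cong (_─ A) V≡) (p─q─r≡p─q∪r (V H) S A)
      ; S⊆V        = ∪-lub S⊆V (p─q⊆p (V H) S ∘ A⊆V─S)
      ; f≡         = f≡-step
      ; ⋃≡         = trans (cong (A ∪_) ⋃≡) (∪-comm A S)
      ; length≤    = subst₂ _≤_ (ℕP.+-comm (length Ss) 1) (sym ∣S∪A∣≡∣S∣+∣A∣)
                            (ℕP.+-mono-≤ length≤ (x∈p⇒∣p∣>0 (proj₂ A-nonempty)))
      }
      where
      f≡-step : ∀ X → f (contract Hi A) X ≡ f H ((S ∪ A) ∪ X) - f H (S ∪ A)
      f≡-step X = begin
        f (contract Hi A) X                                    ≡⟨ f-contract Hi A X ⟩
        f Hi (A ∪ X) - f Hi A                                  ≡⟨ cong₂ _-_ (f≡ (A ∪ X)) (f≡ A) ⟩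
        (f H (S ∪ (A ∪ X)) - f H S) - (f H (S ∪ A) - f H S)   ≡⟨ solve 3 (λ x y z → x :- z :- (y :- z) := x :- y)
                                                                    refl (f H (S ∪ (A ∪ X))) (f H (S ∪ A)) (f H S) ⟩
        f H (S ∪ (A ∪ X)) - f H (S ∪ A)                        ≡⟨ cong (λ Z → f H Z - f H (S ∪ A)) (∪-assoc S A X) ⟨
        f H ((S ∪ A) ∪ X) - f H (S ∪ A)                        ∎
        where open ≡-Reasoning

  run : (∃[ Hf ] Invariant Hf (cardS O ℓ H) (proj₂ (cardLoop n O ℓ H Subset.⊥ [])))
      × (ℓ ≤ ∣ cardS O ℓ H ∣ ⊎ n ℕ.+ 0 ≡ length (proj₂ (cardLoop n O ℓ H Subset.⊥ [])))
  run = cardLoop-invariant Invariant Step.invariant-step n invariant-init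

  ℓ≤∣cardS∣ : ℓ ≤ ∣ cardS O ℓ H ∣
  ℓ≤∣cardS∣ = [ id , all-rounds ]′ (proj₂ run)
    where
    all-rounds : n ℕ.+ 0 ≡ length (proj₂ (cardLoop n O ℓ H Subset.⊥ [])) → ℓ ≤ ∣ cardS O ℓ H ∣
    all-rounds n+0≡length = ℕP.≤-trans ℓ≤∣V∣ (ℕP.≤-trans (∣p∣≤n (V H))
      (subst (_≤ ∣ cardS O ℓ H ∣) (trans (sym n+0≡length) (ℕP.+-identityʳ n)) (Invariant.length≤ (proj₂ (proj₁ run)))))

  cardS⊆V : cardS O ℓ H ⊆ V H
  cardS⊆V = Invariant.S⊆V (proj₂ (proj₁ run))

  module _ (U : Subset n) where

    Proportional : Subset n → Set
    Proportional S = a * f H U * toℚ ∣ S ∣ ≤ℚ (a + b) * f H S * toℚ ∣ U ∣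

    Heavy : Subset n → Set
    Heavy S = a * f H U ≤ℚ (a + b) * f H S

    U⊆S⇒Heavy : ∀ {S} → U ⊆ S → Heavy S
    U⊆S⇒Heavy {S} U⊆S =
      ≤-trans (*-monoˡ-≤-nonNeg′ 0≤a (f-mono wf U⊆S)) (*-monoʳ-≤-nonNeg′ (f-nonNeg wf S) (p≤p+q {a} 0≤b))

    Proportional-⊥ : Proportional Subset.⊥
    Proportional-⊥ = ≤-reflexive (begin
      a * f H U * toℚ ∣ Subset.⊥ {n} ∣    ≡⟨ cong (λ k → a * f H U * toℚ k) (∣⊥∣≡0 n) ⟩
      a * f H U * toℚ 0                  ≡⟨ cong (a * f H U *_) toℚ0≡0 ⟩
      a * f H U * 0ℚ                     ≡⟨ *-zeroʳ (a * f H U) ⟩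
      0ℚ                                 ≡⟨ solve 2 (λ c u → c :* con 0ℚ :* u := con 0ℚ) refl (a + b) (toℚ ∣ U ∣) ⟨
      (a + b) * 0ℚ * toℚ ∣ U ∣            ≡⟨ cong (λ x → (a + b) * x * toℚ ∣ U ∣) (f-⊥ wf) ⟨
      (a + b) * f H Subset.⊥ * toℚ ∣ U ∣  ∎)
      where open ≡-Reasoning

    module _ (0<ℓ : 0 < ℓ) (ℓ≤∣U∣ : ℓ ≤ ∣ U ∣) where

      0<∣U∣ : 0 < ∣ U ∣
      0<∣U∣ = ℕP.<-≤-trans 0<ℓ ℓ≤∣U∣

      Proportional⇒ : ∀ {S} → 0 < ∣ S ∣ → Proportional S → a * Γ H U ≤ℚ (a + b) * Γ H S
      Proportional⇒ = cross⇒*Γ≤*Γ H a (a + b) 0<∣U∣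

      Heavy⇒ : ∀ {P S} → Heavy P → P ⊆ S → ∣ S ∣ ≡ ℓ → a * Γ H U ≤ℚ (a + b) * Γ H S
      Heavy⇒ {P} {S} heavy P⊆S ∣S∣≡ℓ = cross⇒*Γ≤*Γ H a (a + b) 0<∣U∣ (subst (0 <_) (sym ∣S∣≡ℓ) 0<ℓ) (begin
        a * f H U * toℚ ∣ S ∣        ≤⟨ *-monoʳ-≤-nonNeg′ (toℚ-nonNeg ∣ S ∣) heavy ⟩
        (a + b) * f H P * toℚ ∣ S ∣  ≤⟨ *-monoʳ-≤-nonNeg′ (toℚ-nonNeg ∣ S ∣) (*-monoˡ-≤-nonNeg′ 0≤a+b (f-mono wf P⊆S)) ⟩
        (a + b) * f H S * toℚ ∣ S ∣  ≤⟨ *-monoˡ-≤-nonNeg′ (*-nonNeg 0≤a+b (f-nonNeg wf S))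
                                                          (toℚ-mono (subst (_≤ ∣ U ∣) (sym ∣S∣≡ℓ) ℓ≤∣U∣)) ⟩
        (a + b) * f H S * toℚ ∣ U ∣  ∎)
        where open ≤-Reasoning

  module _ {U : Subset n} (U⊆V : U ⊆ V H) where

    Proportional-step : ∀ {Hi S Ss} (inv : Invariant Hi S Ss) (∣S∣<ℓ : ∣ S ∣ < ℓ) →
      ¬ Heavy U S → Proportional U S → Proportional U (S ∪ O Hi)
    Proportional-step {Hi} {S} inv ∣S∣<ℓ ¬heavy proportional = begin
      a * f H U * toℚ ∣ S ∪ A ∣                       ≡⟨ cong (λ k → a * f H U * toℚ k) ∣S∪A∣≡∣S∣+∣A∣ ⟩
      a * f H U * toℚ (∣ S ∣ ℕ.+ ∣ A ∣)               ≡⟨ cong (a * f H U *_) (toℚ-+ ∣ S ∣ ∣ A ∣) ⟩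
      a * f H U * (toℚ ∣ S ∣ + toℚ ∣ A ∣)             ≡⟨ *-distribˡ-+ (a * f H U) _ _ ⟩
      a * f H U * toℚ ∣ S ∣ + a * f H U * toℚ ∣ A ∣   ≤⟨ +-mono-≤ proportional gain ⟩
      (a + b) * f H S * u + (a + b) * f Hi A * u      ≡⟨ cong (λ x → (a + b) * f H S * u + (a + b) * x * u) (f≡ A) ⟩
      (a + b) * f H S * u + (a + b) * (f H (S ∪ A) - f H S) * u
        ≡⟨ solve 4 (λ c x y u → c :* x :* u :+ c :* (y :- x) :* u := c :* y :* u) refl (a + b) (f H S) (f H (S ∪ A)) u ⟩
      (a + b) * f H (S ∪ A) * u                       ∎
      where
      open ≤-Reasoning
      open Invariant inv
      open Step inv ∣S∣<ℓ
      u : ℚ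
      u = toℚ ∣ U ∣
      T : Subset n
      T = U ─ S
      T-nonempty : Nonempty T
      T-nonempty = decidable-stable (nonempty? T) (λ T-empty → ¬heavy (U⊆S⇒Heavy U (Empty[p─q]⇒p⊆q U S T-empty)))
      T⊆Vi : T ⊆ V Hi
      T⊆Vi = subst (T ⊆_) (sym V≡) (─-monoˡ S U⊆V)
      fU-fS≤fiT : f H U - f H S ≤ℚ f Hi T
      fU-fS≤fiT = subst (f H U - f H S ≤ℚ_) (sym (f≡ T)) (+-monoˡ-≤ (- f H S) (f-mono wf (p⊆q∪[p─q] U S)))
      cross : a * f Hi T * toℚ ∣ A ∣ ≤ℚ b * f Hi A * toℚ ∣ T ∣
      cross = *Γ≤*Γ⇒cross Hi a b (x∈p⇒∣p∣>0 (proj₂ T-nonempty)) (x∈p⇒∣p∣>0 (proj₂ A-nonempty))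
                (A-approx T T-nonempty T⊆Vi)
      gain : a * f H U * toℚ ∣ A ∣ ≤ℚ (a + b) * f Hi A * u
      gain = gain-bound 0≤a 0≤b (toℚ-pos (x∈p⇒∣p∣>0 (proj₂ A-nonempty))) (f-nonNeg wellFormed A)
               (toℚ-mono (p⊆q⇒∣p∣≤∣q∣ (p─q⊆p U S))) (≰⇒> ¬heavy)
               (≤-trans (*-monoʳ-≤-nonNeg′ (toℚ-nonNeg ∣ A ∣) (*-monoˡ-≤-nonNeg′ 0≤a fU-fS≤fiT)) cross)

    Progress : Instance n → Subset n → List (Subset n) → Set
    Progress Hi S Ss = Invariant Hi S Ss × (Proportional U S ⊎ Heavy U (⋃ (drop 1 Ss)))

    progress-step : ∀ {Hi S Ss} → Progress Hi S Ss → ∣ S ∣ < ℓ →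
      Progress (contract Hi (O Hi)) (S ∪ O Hi) (O Hi ∷ Ss)
    progress-step {Ss = Ss} (inv , inj₂ heavy) ∣S∣<ℓ =
      Step.invariant-step inv ∣S∣<ℓ , inj₂ (≤-trans heavy (*-monoˡ-≤-nonNeg′ 0≤a+b (f-mono wf (⋃-drop-⊆ Ss))))
    progress-step {S = S} (inv , inj₁ proportional) ∣S∣<ℓ = by-cases (a * f H U ≤? (a + b) * f H S)
      where
      by-cases : Dec (Heavy U S) → Progress _ _ _
      by-cases (yes heavy) = Step.invariant-step inv ∣S∣<ℓ , inj₂ (subst (Heavy U) (sym (Invariant.⋃≡ inv)) heavy)
      by-cases (no ¬heavy) = Step.invariant-step inv ∣S∣<ℓ , inj₁ (Proportional-step inv ∣S∣<ℓ ¬heavy proportional)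

    proportional-or-heavy : Proportional U (cardS O ℓ H) ⊎ Heavy U (cardPrefix O ℓ H)
    proportional-or-heavy =
      proj₂ (proj₂ (proj₁ (cardLoop-invariant Progress progress-step n (invariant-init , inj₁ (Proportional-⊥ U)))))

  cardAlg-approx : 0 < ℓ → ∀ {S′} → IsPadding O ℓ H S′ →
      (ℓ ≤ ∣ cardAlg O ℓ H S′ ∣)
    × (cardAlg O ℓ H S′ ⊆ V H)
    × (∀ U → U ⊆ V H → ℓ ≤ ∣ U ∣ → a * Γ H U ≤ℚ (a + b) * Γ H (cardAlg O ℓ H S′))
  cardAlg-approx 0<ℓ {S′} (prefix⊆S′ , S′⊆V , ∣S′∣≡ℓ) =
      denser-preserves H S S′ (λ Z → ℓ ≤ ∣ Z ∣) ℓ≤∣cardS∣ (ℕP.≤-reflexive (sym ∣S′∣≡ℓ))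
    , denser-preserves H S S′ (_⊆ V H) cardS⊆V S′⊆V
    , bound
    where
    S : Subset n
    S = cardS O ℓ H
    bound : ∀ U → U ⊆ V H → ℓ ≤ ∣ U ∣ → a * Γ H U ≤ℚ (a + b) * Γ H (cardAlg O ℓ H S′)
    bound U U⊆V ℓ≤∣U∣ = [ via-proportional , via-heavy ]′ (proportional-or-heavy U⊆V)
      where
      via-proportional : Proportional U S → a * Γ H U ≤ℚ (a + b) * Γ H (cardAlg O ℓ H S′)
      via-proportional proportional =
        ≤-trans (Proportional⇒ U 0<ℓ ℓ≤∣U∣ (ℕP.<-≤-trans 0<ℓ ℓ≤∣cardS∣) proportional)
                (*-monoˡ-≤-nonNeg′ 0≤a+b (Γ≤Γ-denserˡ H S S′))
      via-heavy : Heavy U (cardPrefix O ℓ H) → a * Γ H U ≤ℚ (a + b) * Γ H (cardAlg O ℓ H S′)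
      via-heavy heavy =
        ≤-trans (Heavy⇒ U 0<ℓ ℓ≤∣U∣ heavy prefix⊆S′ ∣S′∣≡ℓ) (*-monoˡ-≤-nonNeg′ 0≤a+b (Γ≤Γ-denserʳ H S S′))

-- Peeling

-- `score` sums a function that is local to its definition in Defs; unifying with `score` recovers it.
scoreTerm : Instance n → (Edge n → ℕ → ℚ) → Subset n → Fin n → Edge n → ℚ
scoreTerm {n} H s X u = summand (score H s X u) refl
  where
  summand : ∀ x {g : Edge n → ℚ} → x ≡ sumℚ (map g (edges H)) → Edge n → ℚ
  summand _ {g} _ = g

edgeScore : (Edge n → ℕ → ℚ) → Edge n → ℕ → ℚ
edgeScore s e i = ρ e i - s e (i ∸ 1)

module _ (H : Instance n) (s : Edge n → ℕ → ℚ) (X : Subset n) {u : Fin n} (e : Edge n) where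

  scoreTerm-∈ : u ∈ₛ nodes e → scoreTerm H s X u e ≡ edgeScore s e ∣ nodes e ∩ X ∣
  scoreTerm-∈ u∈e with u ∈? nodes e
  ... | yes _   = refl
  ... | no  u∉e = ⊥-elim (u∉e u∈e)

  scoreTerm-∉ : u ∉ₛ nodes e → scoreTerm H s X u e ≡ 0ℚ
  scoreTerm-∉ u∉e with u ∈? nodes e
  ... | yes u∈e = ⊥-elim (u∉e u∈e)
  ... | no  _   = refl

LocallyDense : Instance n → Subset n → Set
LocallyDense H W = ∀ v → v ∈ₛ W → Γ H W ≤ℚ f H W - f H (W -ₛ v)

DenseCore : Instance n → Subset n → Subset n → Set
DenseCore H U W = W ⊆ U × Nonempty W × Γ H U ≤ℚ Γ H W × LocallyDense H W

module _ {n} {H : Instance n} (wf : WellFormed H) where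

  removal-densifies : ∀ {U v} → v ∈ₛ U → f H U - f H (U -ₛ v) <ℚ Γ H U →
    Nonempty (U -ₛ v) × Γ H U ≤ℚ Γ H (U -ₛ v)
  removal-densifies {U} {v} v∈U small-loss = U-v-nonempty , ΓU≤ΓU-v
    where
    γ : ℚ
    γ = Γ H U
    m : ℕ
    m = ∣ U -ₛ v ∣
    fU≡ : f H U ≡ γ * (1ℚ + toℚ m)
    fU≡ = begin
      f H U             ≡⟨ Γ*∣S∣≡f H U (x∈p⇒∣p∣>0 v∈U) ⟨
      γ * toℚ ∣ U ∣     ≡⟨ cong (λ k → γ * toℚ k) (1+∣p-x∣≡∣p∣ U v∈U) ⟨
      γ * toℚ (suc m)   ≡⟨ cong (γ *_) (toℚ-+ 1 m) ⟩
      γ * (1ℚ + toℚ m)  ∎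
      where open ≡-Reasoning
    γm<fU-v : γ * toℚ m <ℚ f H (U -ₛ v)
    γm<fU-v = 0<q-p⇒p<q (subst (0ℚ <ℚ_)
      (trans (cong (λ x → γ - (x - f H (U -ₛ v))) fU≡)
             (solve 3 (λ γ t f′ → γ :- (γ :* (con 1ℚ :+ t) :- f′) := f′ :- γ :* t) refl γ (toℚ m) (f H (U -ₛ v))))
      (p<q⇒0<q-p small-loss))
    U-v-nonempty : Nonempty (U -ₛ v)
    U-v-nonempty = f-pos⇒Nonempty wf (≤-<-trans (*-nonNeg (Γ-nonNeg wf U) (toℚ-nonNeg m)) γm<fU-v)
    ΓU≤ΓU-v : Γ H U ≤ℚ Γ H (U -ₛ v)
    ΓU≤ΓU-v = subst (γ ≤ℚ_) (*-identityˡ (Γ H (U -ₛ v))) (≤*Γ H (U -ₛ v) {γ} {1ℚ} (x∈p⇒∣p∣>0 (proj₂ U-v-nonempty))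
      (subst (γ * toℚ m ≤ℚ_) (sym (*-identityˡ (f H (U -ₛ v)))) (<⇒≤ γm<fU-v)))

  denseCore : ∀ k U → ∣ U ∣ ≤ k → Nonempty U → ∃[ W ] DenseCore H U W
  denseCore zero    U ∣U∣≤0     (u , u∈U)  = ⊥-elim (ℕP.<⇒≱ (x∈p⇒∣p∣>0 u∈U) ∣U∣≤0)
  denseCore (suc k) U ∣U∣≤1+k U-nonempty = by-cases (all? dense-at?)
    where
    dense-at? : ∀ v → Dec (v ∈ₛ U → Γ H U ≤ℚ f H U - f H (U -ₛ v))
    dense-at? v = (v ∈? U) →-dec (Γ H U ≤? f H U - f H (U -ₛ v))
    descend : ∀ {v} → v ∈ₛ U → ¬ (Γ H U ≤ℚ f H U - f H (U -ₛ v)) → ∃[ W ] DenseCore H U W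
    descend {v} v∈U not-dense-at-v =
      let U-v-nonempty , ΓU≤ΓU-v = removal-densifies v∈U (≰⇒> not-dense-at-v)
          W , W⊆U-v , W-nonempty , ΓU-v≤ΓW , W-dense = denseCore k (U -ₛ v)
            (ℕP.≤-pred (subst (_≤ suc k) (sym (1+∣p-x∣≡∣p∣ U v∈U)) ∣U∣≤1+k)) U-v-nonempty
      in W , p─q⊆p U _ ∘ W⊆U-v , W-nonempty , ≤-trans ΓU≤ΓU-v ΓU-v≤ΓW , W-dense
    by-cases : Dec (LocallyDense H U) → ∃[ W ] DenseCore H U W
    by-cases (yes U-dense) = U , id , U-nonempty , ≤-refl , U-dense
    by-cases (no ¬U-dense) =
      let v , not-dense-at-v = ¬∀⟶∃¬ n _ dense-at? ¬U-dense
      in descend (decidable-stable (v ∈? U) (λ v∉U → not-dense-at-v (⊥-elim ∘ v∉U))) (not-dense-at-v ∘ const)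

module Peeling {n} {H : Instance n} (wf : WellFormed H) {s : Edge n → ℕ → ℚ} (bounds : BoundsOK H s)
  {K : ℕ} (maxEdgeSize≤K : maxEdgeSize H ≤ K) where

  module _ {e : Edge n} (e∈H : e ∈ edges H) where

    s-bounds : ∀ {i} → i ≤ ∣ nodes e ∣ → 0ℚ ≤ℚ s e i × s e i ≤ℚ ρ e i
    s-bounds = proj₁ (bounds e e∈H) _

    edgeScore-mono : ∀ {i j} → 1 ≤ i → i ≤ j → j ≤ ∣ nodes e ∣ → edgeScore s e i ≤ℚ edgeScore s e j
    edgeScore-mono 1≤i i≤j j≤∣e∣ = stepwise-mono (edgeScore s e) i≤j
      (λ k i≤k k<j → proj₂ (bounds e e∈H) k (ℕP.≤-trans 1≤i i≤k) (ℕP.≤-trans k<j j≤∣e∣))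

    i*edgeScore≤K*ρ : ∀ i → i ≤ ∣ nodes e ∣ → toℚ i * edgeScore s e i ≤ℚ toℚ K * ρ e i
    i*edgeScore≤K*ρ zero    _       = subst (_≤ℚ toℚ K * ρ e 0)
      (sym (trans (cong (_* edgeScore s e 0) toℚ0≡0) (*-zeroˡ (edgeScore s e 0))))
      (*-nonNeg (toℚ-nonNeg K) (ρ-nonNeg wf e∈H z≤n))
    i*edgeScore≤K*ρ (suc i) 1+i≤∣e∣ = begin
      toℚ (suc i) * (ρ e (suc i) - s e i)  ≤⟨ *-monoʳ-≤-nonNeg′ 0≤edgeScore (toℚ-mono (ℕP.≤-trans 1+i≤∣e∣ ∣e∣≤K)) ⟩
      toℚ K * (ρ e (suc i) - s e i)        ≤⟨ *-monoˡ-≤-nonNeg′ (toℚ-nonNeg K) (p-q≤p (proj₁ (s-bounds i≤∣e∣))) ⟩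
      toℚ K * ρ e (suc i)                  ∎
      where
      open ≤-Reasoning
      i≤∣e∣ : i ≤ ∣ nodes e ∣
      i≤∣e∣ = ℕP.≤-trans (ℕP.n≤1+n i) 1+i≤∣e∣
      ∣e∣≤K : ∣ nodes e ∣ ≤ K
      ∣e∣≤K = ℕP.≤-trans (∣e∣≤maxEdgeSize H e∈H) maxEdgeSize≤K
      0≤edgeScore : 0ℚ ≤ℚ ρ e (suc i) - s e i
      0≤edgeScore = p≤q⇒0≤q-p (≤-trans (proj₂ (s-bounds i≤∣e∣)) (ρ-mono wf e∈H (ℕP.n≤1+n i) 1+i≤∣e∣))

    loss≤scoreTerm : ∀ {X W v} → W ⊆ X → v ∈ₛ W → edgeValue e W - edgeValue e (W -ₛ v) ≤ℚ scoreTerm H s X v e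
    loss≤scoreTerm {X} {W} {v} W⊆X v∈W = by-cases (v ∈? nodes e)
      where
      by-cases : Dec (v ∈ₛ nodes e) → edgeValue e W - edgeValue e (W -ₛ v) ≤ℚ scoreTerm H s X v e
      by-cases (no v∉e) = ≤-reflexive (begin
        edgeValue e W - edgeValue e (W -ₛ v)  ≡⟨ cong (λ k → edgeValue e W - ρ e k) (∣p∩[q-x]∣≡∣p∩q∣ (nodes e) W v∉e) ⟩
        edgeValue e W - edgeValue e W         ≡⟨ +-inverseʳ (edgeValue e W) ⟩
        0ℚ                                    ≡⟨ scoreTerm-∉ H s X e v∉e ⟨
        scoreTerm H s X v e                   ∎)
        where open ≡-Reasoning
      by-cases (yes v∈e) = begin
        edgeValue e W - ρ e w  ≡⟨ cong (λ k → ρ e k - ρ e w) (sym 1+w≡∣e∩W∣) ⟩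
        ρ e (suc w) - ρ e w    ≤⟨ p-r≤p-q (ρ e (suc w)) (proj₂ (s-bounds w≤∣e∣)) ⟩
        ρ e (suc w) - s e w    ≤⟨ edgeScore-mono (s≤s z≤n) 1+w≤x x≤∣e∣ ⟩
        edgeScore s e x        ≡⟨ scoreTerm-∈ H s X e v∈e ⟨
        scoreTerm H s X v e    ∎
        where
        open ≤-Reasoning
        w x : ℕ
        w = ∣ nodes e ∩ (W -ₛ v) ∣
        x = ∣ nodes e ∩ X ∣
        1+w≡∣e∩W∣ : suc w ≡ ∣ nodes e ∩ W ∣
        1+w≡∣e∩W∣ = 1+∣p∩[q-x]∣≡∣p∩q∣ (nodes e) W v∈e v∈W
        x≤∣e∣ : x ≤ ∣ nodes e ∣
        x≤∣e∣ = ∣p∩q∣≤∣p∣ (nodes e) X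
        1+w≤x : suc w ≤ x
        1+w≤x = subst (_≤ x) (sym 1+w≡∣e∩W∣) (p⊆q⇒∣p∣≤∣q∣ (∩-monoʳ-⊆ (nodes e) W⊆X))
        w≤∣e∣ : w ≤ ∣ nodes e ∣
        w≤∣e∣ = ℕP.≤-trans (ℕP.n≤1+n w) (ℕP.≤-trans 1+w≤x x≤∣e∣)

  loss≤score : ∀ {X W v} → W ⊆ X → v ∈ₛ W → f H W - f H (W -ₛ v) ≤ℚ score H s X v
  loss≤score {X} {W} {v} W⊆X v∈W =
    subst (_≤ℚ score H s X v) (sumℚ-distrib-─ (λ e → edgeValue e W) (λ e → edgeValue e (W -ₛ v)) (edges H))
      (sumℚ-mono (edges H) (λ e e∈H → loss≤scoreTerm e∈H W⊆X v∈W))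

  ∣X∣*score≤K*f : ∀ X {v} → (∀ u → u ∈ₛ X → score H s X v ≤ℚ score H s X u) →
    toℚ ∣ X ∣ * score H s X v ≤ℚ toℚ K * f H X
  ∣X∣*score≤K*f X {v} minimal = begin
    toℚ ∣ X ∣ * score H s X v
      ≤⟨ ∣X∣*c≤sumOver X (score H s X) {score H s X v} minimal ⟩
    ∑[ u ∈ X ] sumℚ (map (scoreTerm H s X u) (edges H))
      ≡⟨ sumOver-sumℚ X (scoreTerm H s X) (edges H) ⟩
    sumℚ (map (λ e → ∑[ u ∈ X ] scoreTerm H s X u e) (edges H))
      ≡⟨ sumℚ-cong (edges H) (λ e _ → per-edge e) ⟩
    sumℚ (map (λ e → toℚ ∣ nodes e ∩ X ∣ * edgeScore s e ∣ nodes e ∩ X ∣) (edges H))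
      ≤⟨ sumℚ-mono (edges H) (λ e e∈H → i*edgeScore≤K*ρ e∈H _ (∣p∩q∣≤∣p∣ (nodes e) X)) ⟩
    sumℚ (map (λ e → toℚ K * edgeValue e X) (edges H))
      ≡⟨ sumℚ-distribˡ-* (toℚ K) (λ e → edgeValue e X) (edges H) ⟩
    toℚ K * f H X
      ∎
    where
    open ≤-Reasoning
    per-edge : ∀ e → ∑[ u ∈ X ] scoreTerm H s X u e ≡ toℚ ∣ nodes e ∩ X ∣ * edgeScore s e ∣ nodes e ∩ X ∣
    per-edge e = sumOver-indicator X (nodes e) (λ u → scoreTerm H s X u e) (λ _ → scoreTerm-∈ H s X e)
                   (λ _ → scoreTerm-∉ H s X e)

  Γ≤K*Γ : ∀ {W X v} → LocallyDense H W → W ⊆ X → v ∈ₛ W → (∀ u → u ∈ₛ X → score H s X v ≤ℚ score H s X u) →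
    Γ H W ≤ℚ toℚ K * Γ H X
  Γ≤K*Γ {W} {X} {v} W-dense W⊆X v∈W minimal = ≤*Γ H X {Γ H W} {toℚ K} (x∈p⇒∣p∣>0 (W⊆X v∈W)) (begin
    Γ H W * toℚ ∣ X ∣          ≤⟨ *-monoʳ-≤-nonNeg′ (toℚ-nonNeg ∣ X ∣) (≤-trans (W-dense v v∈W) (loss≤score W⊆X v∈W)) ⟩
    score H s X v * toℚ ∣ X ∣  ≡⟨ *-comm (score H s X v) (toℚ ∣ X ∣) ⟩
    toℚ ∣ X ∣ * score H s X v  ≤⟨ ∣X∣*score≤K*f X {v} minimal ⟩
    toℚ K * f H X              ∎)
    where open ≤-Reasoning

-- In the clause where peelLoop continues, ∣ X′ ∣ has already been split on, so Γ H X′ occurs there unfolded.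
Γ≡ : ∀ (H : Instance n) S {m} → ∣ S ∣ ≡ suc m → Γ H S ≡ f H S * (ℤ.+ 1 / suc m)
Γ≡ H S ∣S∣≡1+m with ∣ S ∣ | ∣S∣≡1+m
... | _ | refl = refl

module _ {n} (H : Instance n) (s : Edge n → ℕ → ℚ) (ch : Chooser n) where

  chosen : Subset n → Fin n
  chosen X = ch H X (score H s X)

  peelLoop-suc : ∀ k X Y →
      (∣ X -ₛ chosen X ∣ ≡ 0 × peelLoop (suc k) H s ch X Y ≡ Y)
    ⊎ (0 < ∣ X -ₛ chosen X ∣
       × peelLoop (suc k) H s ch X Y ≡ peelLoop k H s ch (X -ₛ chosen X) (denser H (X -ₛ chosen X) Y))
  peelLoop-suc k X Y with ∣ X ∣ in ∣X∣≡
  ... | zero  = inj₁ (ℕP.n≤0⇒n≡0 (subst (∣ X -ₛ chosen X ∣ ≤_) ∣X∣≡ (∣p─q∣≤∣p∣ X _)) , refl)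
  ... | suc _ with X -ₛ chosen X
  ...   | X′ with ∣ X′ ∣ in ∣X′∣≡
  ...     | zero  = inj₁ (refl , refl)
  ...     | suc m =
    inj₂ (s≤s z≤n , cong (λ γ → peelLoop k H s ch X′ (if ⌊ γ <? Γ H Y ⌋ then Y else X′)) (Γ≡ H X′ ∣X′∣≡))

  peelLoop-improves : ∀ k {X Y} → X ⊆ V H → Y ⊆ V H → Nonempty Y →
      peelLoop k H s ch X Y ⊆ V H × Nonempty (peelLoop k H s ch X Y) × Γ H Y ≤ℚ Γ H (peelLoop k H s ch X Y)
  peelLoop-improves zero    X⊆V Y⊆V Y-nonempty = Y⊆V , Y-nonempty , ≤-refl
  peelLoop-improves (suc k) {X} {Y} X⊆V Y⊆V Y-nonempty = [ stop , continue ]′ (peelLoop-suc k X Y)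
    where
    X′ : Subset n
    X′ = X -ₛ chosen X
    X′⊆V : X′ ⊆ V H
    X′⊆V = X⊆V ∘ p─q⊆p X _
    Improves : Subset n → Set
    Improves Z = Z ⊆ V H × Nonempty Z × Γ H Y ≤ℚ Γ H Z
    stop : ∣ X′ ∣ ≡ 0 × peelLoop (suc k) H s ch X Y ≡ Y → Improves (peelLoop (suc k) H s ch X Y)
    stop (_ , result≡Y) = subst Improves (sym result≡Y) (Y⊆V , Y-nonempty , ≤-refl)
    continue : 0 < ∣ X′ ∣ × peelLoop (suc k) H s ch X Y ≡ peelLoop k H s ch X′ (denser H X′ Y) →
      Improves (peelLoop (suc k) H s ch X Y)
    continue (0<∣X′∣ , result≡) =
      let Z⊆V , Z-nonempty , ΓY′≤ΓZ = peelLoop-improves k X′⊆V (denser-preserves H X′ Y (_⊆ V H) X′⊆V Y⊆V)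
            (denser-preserves H X′ Y Nonempty (∣p∣>0⇒Nonempty 0<∣X′∣) Y-nonempty)
      in subst Improves (sym result≡) (Z⊆V , Z-nonempty , ≤-trans (Γ≤Γ-denserʳ H X′ Y) ΓY′≤ΓZ)

module PeelingLoop {n} {H : Instance n} (wf : WellFormed H) {s : Edge n → ℕ → ℚ} (bounds : BoundsOK H s)
  {K : ℕ} (maxEdgeSize≤K : maxEdgeSize H ≤ K) {ch : Chooser n} (argmin : IsArgminChooser ch) where

  open Peeling wf bounds maxEdgeSize≤K

  peelLoop-approx : ∀ k {W X Y} → ∣ X ∣ ≤ k → LocallyDense H W → Nonempty W → W ⊆ X → Γ H X ≤ℚ Γ H Y →
    X ⊆ V H → Y ⊆ V H → Nonempty Y → Γ H W ≤ℚ toℚ K * Γ H (peelLoop k H s ch X Y)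
  peelLoop-approx zero    ∣X∣≤0 _ (w , w∈W) W⊆X _ _ _ _ = ⊥-elim (ℕP.<⇒≱ (x∈p⇒∣p∣>0 (W⊆X w∈W)) ∣X∣≤0)
  peelLoop-approx (suc k) {W} {X} {Y} ∣X∣≤1+k W-dense (w , w∈W) W⊆X ΓX≤ΓY X⊆V Y⊆V Y-nonempty =
    by-cases (v ∈? W)
    where
    v : Fin n
    v = chosen H s ch X
    v∈X : v ∈ₛ X
    v∈X = proj₁ (argmin H X (score H s X) (w , W⊆X w∈W))
    minimal : ∀ u → u ∈ₛ X → score H s X v ≤ℚ score H s X u
    minimal = proj₂ (argmin H X (score H s X) (w , W⊆X w∈W))
    X′ : Subset n
    X′ = X -ₛ v
    by-cases : Dec (v ∈ₛ W) → Γ H W ≤ℚ toℚ K * Γ H (peelLoop (suc k) H s ch X Y)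
    by-cases (yes v∈W) = ≤-trans (Γ≤K*Γ {v = v} W-dense W⊆X v∈W minimal) (*-monoˡ-≤-nonNeg′ (toℚ-nonNeg K)
      (≤-trans ΓX≤ΓY (proj₂ (proj₂ (peelLoop-improves H s ch (suc k) X⊆V Y⊆V Y-nonempty)))))
    by-cases (no v∉W) = [ stop , continue ]′ (peelLoop-suc H s ch k X Y)
      where
      W⊆X′ : W ⊆ X′
      W⊆X′ x∈W = x∈p∧x≢y⇒x∈p-y (W⊆X x∈W) (λ { refl → v∉W x∈W })
      stop : ∣ X′ ∣ ≡ 0 × peelLoop (suc k) H s ch X Y ≡ Y → Γ H W ≤ℚ toℚ K * Γ H (peelLoop (suc k) H s ch X Y)
      stop (∣X′∣≡0 , _) = ⊥-elim (ℕP.<⇒≢ (x∈p⇒∣p∣>0 (W⊆X′ w∈W)) (sym ∣X′∣≡0))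
      continue : 0 < ∣ X′ ∣ × peelLoop (suc k) H s ch X Y ≡ peelLoop k H s ch X′ (denser H X′ Y) →
        Γ H W ≤ℚ toℚ K * Γ H (peelLoop (suc k) H s ch X Y)
      continue (_ , result≡) = subst (λ Z → Γ H W ≤ℚ toℚ K * Γ H Z) (sym result≡)
        (peelLoop-approx k (ℕP.≤-pred (subst (_≤ suc k) (sym (1+∣p-x∣≡∣p∣ X v∈X)) ∣X∣≤1+k)) W-dense (w , w∈W) W⊆X′
          (Γ≤Γ-denserˡ H X′ Y) (X⊆V ∘ p─q⊆p X _) (denser-preserves H X′ Y (_⊆ V H) (X⊆V ∘ p─q⊆p X _) Y⊆V)
          (denser-preserves H X′ Y Nonempty (w , W⊆X′ w∈W) Y-nonempty))

peel-approx : ∀ {n} {s : Instance n → Edge n → ℕ → ℚ} → (∀ H → WellFormed H → BoundsOK H (s H)) →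
  ∀ {ch} → IsArgminChooser ch → ∀ K → IsApproxOn (λ H → maxEdgeSize H ≤ K) 1ℚ (toℚ K) (peel s ch)
peel-approx {n} {s} bounds {ch} argmin K H maxEdgeSize≤K wf V-nonempty =
  proj₁ (proj₂ improves) , proj₁ improves , bound
  where
  improves : peel s ch H ⊆ V H × Nonempty (peel s ch H) × Γ H (V H) ≤ℚ Γ H (peel s ch H)
  improves = peelLoop-improves H (s H) ch n id id V-nonempty
  bound : ∀ T → Nonempty T → T ⊆ V H → 1ℚ * Γ H T ≤ℚ toℚ K * Γ H (peel s ch H)
  bound T T-nonempty T⊆V =
    let W , W⊆T , W-nonempty , ΓT≤ΓW , W-dense = denseCore wf n T (∣p∣≤n T) T-nonempty in
    subst (_≤ℚ toℚ K * Γ H (peel s ch H)) (sym (*-identityˡ (Γ H T))) (≤-trans ΓT≤ΓW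
      (PeelingLoop.peelLoop-approx wf (bounds H wf) maxEdgeSize≤K argmin n (∣p∣≤n (V H)) W-dense W-nonempty
        (T⊆V ∘ W⊆T) ≤-refl id id V-nonempty))

theorem7 :
  -- (1) generic reduction from an α-approximation for SWAMP
  (∀ {n} (α : ℚ) → 0ℚ ≤ℚ α → (O : Instance n → Subset n) → IsApprox α O →
    ∀ (H : Instance n) → WellFormed H →
    ∀ (ℓ : ℕ) → 1 ≤ ℓ → ℓ ≤ ∣ V H ∣ →
    ∀ (S' : Subset n) → IsPadding O ℓ H S' →
      (ℓ ≤ ∣ cardAlg O ℓ H S' ∣)
    × (cardAlg O ℓ H S' ⊆ V H)
    × (∀ (U : Subset n) → U ⊆ V H → ℓ ≤ ∣ U ∣ →
         α * Γ H U ≤ℚ (α + 1ℚ) * Γ H (cardAlg O ℓ H S')))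
  ×
  -- (2) with the peeling algorithm as subroutine: 1/(k+1)-approximation
  (∀ {n} (s : Instance n → Edge n → ℕ → ℚ) →
    (∀ (H : Instance n) → WellFormed H → BoundsOK H (s H)) →
    (ch : Chooser n) → IsArgminChooser ch →
    ∀ (H : Instance n) → WellFormed H →
    ∀ (ℓ : ℕ) → 1 ≤ ℓ → ℓ ≤ ∣ V H ∣ →
    ∀ (S' : Subset n) → IsPadding (peel s ch) ℓ H S' →
      (ℓ ≤ ∣ cardAlg (peel s ch) ℓ H S' ∣)
    × (cardAlg (peel s ch) ℓ H S' ⊆ V H)
    × (∀ (U : Subset n) → U ⊆ V H → ℓ ≤ ∣ U ∣ →
         Γ H U ≤ℚ (toℚ (maxEdgeSize H) + 1ℚ) * Γ H (cardAlg (peel s ch) ℓ H S')))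
theorem7 =
    (λ α 0≤α O approx H wf ℓ 0<ℓ ℓ≤∣V∣ S′ →
       Reduction.cardAlg-approx (λ _ _ → tt) 0≤α (toℚ-nonNeg 1) (IsApprox⇒IsApproxOn {α = α} approx) wf tt ℓ≤∣V∣ 0<ℓ)
  , (λ s bounds ch argmin H wf ℓ 0<ℓ ℓ≤∣V∣ S′ padding →
       let K = maxEdgeSize H
           size , ⊆V , bound = Reduction.cardAlg-approx (λ {Hi} A → ℕP.≤-trans (maxEdgeSize-contract Hi A))
                                 (toℚ-nonNeg 1) (toℚ-nonNeg K) (peel-approx bounds argmin K)
                                 wf ℕP.≤-refl ℓ≤∣V∣ 0<ℓ padding
       in size , ⊆V , λ U U⊆V ℓ≤∣U∣ →
            subst₂ _≤ℚ_ (*-identityˡ (Γ H U)) (cong (_* Γ H (cardAlg (peel s ch) ℓ H S′)) (+-comm 1ℚ (toℚ K)))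
              (bound U U⊆V ℓ≤∣U∣))
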